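{- Let $n\ge3$ be an integer, let $D_n=\langle a,b\mid a^n=b^2=1,\ ab=ba^{ -1}\rangle$ be the dihedral group of order $2n$ and $Q_n=\langle a,b\mid a^{2n}=b^4=1,\ b^2=a^n,\ ab=ba^{ -1}\rangle$ the generalized quaternion (dicyclic) group of order $4n$. Then $\Gamma_N(Q_n)\cong\Gamma_N(D_n)$.
   Context: $\Gamma_N(G)$ denotes the simple graph whose vertices are the proper non-normal subgroups of the group $G$, two distinct vertices $H,K$ being adjacent iff $HK=KH$. -}

module Defs where

open import Data.Nat using (ℕ; zero; suc; _+_; _*_; _∸_; NonZero)
open import Data.Nat.Properties using (m*n≢0)
open import Data.Nat.DivMod using (_mod_)
open import Data.Fin using (Fin; toℕ)
open import Data.Fin.Subset as FS using (Subset)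
open import Data.Bool using (Bool; true; false; not)
open import Data.Product using (Σ; _×_; _,_)
open import Relation.Binary.PropositionalEquality using (_≡_)
open import Relation.Nullary using (¬_)
open import Function.Bundles using (_⇔_)

_+ℕ_ : ∀ {m} → Fin m → ℕ → Fin m
_+ℕ_ {suc m} i k = (toℕ i + k) mod (suc m)

_⊕_ : ∀ {m} → Fin m → Fin m → Fin m
i ⊕ j = i +ℕ toℕ j

⊖_ : ∀ {m} → Fin m → Fin m
⊖_ {suc m} j = (suc m ∸ toℕ j) mod (suc m)

_⊝_ : ∀ {m} → Fin m → Fin m → Fin m
i ⊝ j = i ⊕ (⊖ j)


-- Groups whose elements are written a^k b^s with k ∈ ℤ/mℤ, s ∈ {0,1};
-- the pair (k , s) stands for a^k b^s (s = true meaning b^1).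

Elt : ℕ → Set
Elt m = Fin m × Bool

record Grp (m : ℕ) : Set where
  field
    _·_ : Elt m → Elt m → Elt m
    e   : Elt m
    _⁻¹ : Elt m → Elt m

-- Dihedral group D_n = ⟨a,b | a^n = b^2 = 1, ab = ba⁻¹⟩, order 2n.
-- a^i b^s · a^j b^t = a^(i + (-1)^s j) b^(s+t)
Dih : (n : ℕ) → .{{_ : NonZero n}} → Grp n
Dih n = record { _·_ = mul ; e = (0 mod n , false) ; _⁻¹ = inv }
  where
  mul : Elt n → Elt n → Elt n
  mul (i , false) (j , t) = (i ⊕ j , t)
  mul (i , true)  (j , t) = (i ⊝ j , not t)
  inv : Elt n → Elt n
  inv (i , false) = (⊖ i , false)
  inv (i , true)  = (i , true)

-- Generalized quaternion (dicyclic) group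
-- Q_n = ⟨a,b | a^(2n) = b^4 = 1, b^2 = a^n, ab = ba⁻¹⟩, order 4n.
-- Elements a^k b^s with k ∈ ℤ/2nℤ, s ∈ {0,1}; b^2 = a^n.
Dic : (n : ℕ) → .{{_ : NonZero n}} → Grp (2 * n)
Dic n = record { _·_ = mul ; e = (_mod_ 0 (2 * n) {{m*n≢0 2 n}} , false) ; _⁻¹ = inv }
  where
  mul : Elt (2 * n) → Elt (2 * n) → Elt (2 * n)
  mul (i , false) (j , t)     = (i ⊕ j , t)
  mul (i , true)  (j , false) = (i ⊝ j , true)
  mul (i , true)  (j , true)  = ((i ⊝ j) +ℕ n , false)
  -- (a^i b)⁻¹ = b³ a^(-i) = a^(i+n) b
  inv : Elt (2 * n) → Elt (2 * n)
  inv (i , false) = (⊖ i , false)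
  inv (i , true)  = (i +ℕ n , true)

-- Subsets of Elt m: a pair (R , S) of subsets of Fin m,
-- R = {k | a^k ∈ X}, S = {k | a^k b ∈ X}.

Sub : ℕ → Set
Sub m = Subset m × Subset m

_∈ₛ_ : ∀ {m} → Elt m → Sub m → Set
(k , false) ∈ₛ (R , S) = k FS.∈ R
(k , true)  ∈ₛ (R , S) = k FS.∈ S

full : ∀ {m} → Sub m
full = (FS.⊤ , FS.⊤)

module _ {m : ℕ} (G : Grp m) where
  open Grp G

  record IsSubgroup (H : Sub m) : Set where
    field
      has-e   : e ∈ₛ H
      closed· : ∀ x y → x ∈ₛ H → y ∈ₛ H → (x · y) ∈ₛ H
      closed⁻ : ∀ x → x ∈ₛ H → (x ⁻¹) ∈ₛ H

  IsNormal : Sub m → Set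
  IsNormal H = ∀ g h → h ∈ₛ H → ((g · h) · (g ⁻¹)) ∈ₛ H

  IsVertex : Sub m → Set
  IsVertex H = IsSubgroup H × (¬ H ≡ full) × (¬ IsNormal H)

  _∈_⊗_ : Elt m → Sub m → Sub m → Set
  x ∈ H ⊗ K = Σ (Elt m) λ h → Σ (Elt m) λ k → h ∈ₛ H × k ∈ₛ K × x ≡ h · k

  Permutable : Sub m → Sub m → Set
  Permutable H K = ∀ x → (x ∈ H ⊗ K) ⇔ (x ∈ K ⊗ H)

  Adj : Sub m → Sub m → Set
  Adj H K = (¬ H ≡ K) × Permutable H K

-- Graph isomorphism Γ_N(G₁) ≅ Γ_N(G₂): a map on subsets that restricts to a
-- bijection between the vertex sets and preserves and reflects adjacency.
ΓN-Iso : ∀ {m₁ m₂} → Grp m₁ → Grp m₂ → Set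
ΓN-Iso {m₁} {m₂} G₁ G₂ =
  Σ (Sub m₁ → Sub m₂) λ f →
    (∀ H → IsVertex G₁ H → IsVertex G₂ (f H))
  × (∀ H K → IsVertex G₁ H → IsVertex G₁ K → f H ≡ f K → H ≡ K)
  × (∀ H′ → IsVertex G₂ H′ → Σ (Sub m₁) λ H → IsVertex G₁ H × f H ≡ H′)
  × (∀ H K → IsVertex G₁ H → IsVertex G₁ K → Adj G₁ H K ⇔ Adj G₂ (f H) (f K))

module Submission where

-- Reducing exponents of a modulo n gives a surjective homomorphism
-- π : Q_n → D_n, a^k b^s ↦ a^(k mod n) b^s, whose fibres are the cosets
-- {x, x·z} of the central involution z = a^n = b².  Every non-normal subgroup
-- H of Q_n contains z: it contains some a^k b (otherwise H ≤ ⟨a⟩ would be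
-- normal), and (a^k b)² = z.  So the correspondence theorem applies: on
-- subgroups containing z, H ↦ π(H) is a bijection onto the subgroups of D_n
-- which preserves properness, normality and permutability.

open import Defs
open import Level using (0ℓ)
open import Data.Nat using (ℕ; suc; _+_; _∸_; NonZero; _≤_; _<_)
open import Data.Nat.Properties
  using (+-comm; +-assoc; +-identityʳ; <⇒≤; m∸n+n≡m; m+[n∸m]≡n; m+n∸m≡n;
         ∸-monoˡ-<; ≮⇒≥; _<?_)
open import Data.Nat.DivMod
open import Data.Nat.Divisibility using (_∣_; divides)
open import Data.Nat.Solver using (module +-*-Solver)
open import Data.Fin using (Fin; toℕ)
open import Data.Fin.Properties using (toℕ<n; toℕ-fromℕ<; toℕ-injective)
import Data.Fin.Subset as FS
open import Data.Fin.Subset.Properties using (⊆-antisym; ∈⊤; nonempty?)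
open import Data.Vec using (tabulate; lookup)
open import Data.Vec.Properties using (lookup∘tabulate; []=⇒lookup; lookup⇒[]=)
open import Data.Bool using (Bool; true; false)
open import Data.Product using (Σ; _×_; _,_; proj₁; proj₂)
open import Data.Sum using (_⊎_; inj₁; inj₂)
open import Data.Empty using (⊥-elim)
open import Relation.Nullary using (¬_; yes; no)
open import Relation.Binary.Bundles using (Setoid)
open import Relation.Binary.PropositionalEquality
  using (_≡_; refl; sym; trans; cong; cong₂; subst; module ≡-Reasoning)
import Relation.Binary.Reasoning.Setoid as SetoidReasoning
open import Function.Bundles using (_⇔_; mk⇔; Equivalence)
open import Function.Properties.Equivalence using () renaming (trans to ⇔-trans; sym to ⇔-sym)

open Equivalence using (to; from)

-- Arithmetic of ℤ/Mℤ, M = suc k.  An equation between elements of Fin M is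
-- proved by computing the values toℕ of both sides up to congruence mod M.

module Congruence (k : ℕ) where

  M : ℕ
  M = suc k

  infix 4 _≈_
  record _≈_ (a b : ℕ) : Set where
    constructor ⟨_⟩
    field same-residue : a % M ≡ b % M

  ≈-refl : ∀ {a} → a ≈ a
  ≈-refl = ⟨ refl ⟩

  ≈-sym : ∀ {a b} → a ≈ b → b ≈ a
  ≈-sym ⟨ p ⟩ = ⟨ sym p ⟩

  ≈-trans : ∀ {a b c} → a ≈ b → b ≈ c → a ≈ c
  ≈-trans ⟨ p ⟩ ⟨ q ⟩ = ⟨ trans p q ⟩

  ≈-setoid : Setoid 0ℓ 0ℓ
  ≈-setoid = record
    { Carrier = ℕ ; _≈_ = _≈_
    ; isEquivalence = record { refl = ≈-refl ; sym = ≈-sym ; trans = ≈-trans } }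

  module ≈-Reasoning = SetoidReasoning ≈-setoid

  ≡⇒≈ : ∀ {a b} → a ≡ b → a ≈ b
  ≡⇒≈ refl = ≈-refl

  +-cong : ∀ {a a′ b b′} → a ≈ a′ → b ≈ b′ → a + b ≈ a′ + b′
  +-cong {a} {a′} {b} {b′} ⟨ p ⟩ ⟨ q ⟩ = ⟨ begin
      (a + b) % M            ≡⟨ %-distribˡ-+ a b M ⟩
      (a % M + b % M) % M    ≡⟨ cong₂ (λ u v → (u + v) % M) p q ⟩
      (a′ % M + b′ % M) % M  ≡⟨ %-distribˡ-+ a′ b′ M ⟨
      (a′ + b′) % M          ∎ ⟩
    where open ≡-Reasoning

  +-congˡ : ∀ a {b b′} → b ≈ b′ → a + b ≈ a + b′
  +-congˡ a = +-cong (≈-refl {a})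

  +-congʳ : ∀ {a a′} b → a ≈ a′ → a + b ≈ a′ + b
  +-congʳ b p = +-cong p (≈-refl {b})

  %-≈ : ∀ a → a % M ≈ a
  %-≈ a = ⟨ m%n%n≡m%n a M ⟩

  M≈0 : M ≈ 0
  M≈0 = ⟨ n%n≡0 M ⟩

  +-inverse : ∀ c → c + (M ∸ c % M) ≈ 0
  +-inverse c = begin
      c + (M ∸ c % M)      ≈⟨ +-congʳ (M ∸ c % M) (≈-sym (%-≈ c)) ⟩
      c % M + (M ∸ c % M)  ≡⟨ m+[n∸m]≡n (<⇒≤ (m%n<n c M)) ⟩
      M                    ≈⟨ M≈0 ⟩
      0                    ∎
    where open ≈-Reasoning

  +-cancelʳ : ∀ {a b} c → a + c ≈ b + c → a ≈ b
  +-cancelʳ {a} {b} c p = begin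
      a            ≡⟨ +-identityʳ a ⟨
      a + 0        ≈⟨ +-congˡ a (+-inverse c) ⟨
      a + (c + d)  ≡⟨ +-assoc a c d ⟨
      (a + c) + d  ≈⟨ +-congʳ d p ⟩
      (b + c) + d  ≡⟨ +-assoc b c d ⟩
      b + (c + d)  ≈⟨ +-congˡ b (+-inverse c) ⟩
      b + 0        ≡⟨ +-identityʳ b ⟩
      b            ∎
    where
    open ≈-Reasoning
    d = M ∸ c % M

  toℕ-injective-≈ : ∀ {x y : Fin M} → toℕ x ≈ toℕ y → x ≡ y
  toℕ-injective-≈ {x} {y} ⟨ p ⟩ = toℕ-injective (begin
      toℕ x      ≡⟨ m<n⇒m%n≡m (toℕ<n x) ⟨
      toℕ x % M  ≡⟨ p ⟩
      toℕ y % M  ≡⟨ m<n⇒m%n≡m (toℕ<n y) ⟩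
      toℕ y      ∎)
    where open ≡-Reasoning

  toℕ-mod : ∀ a → toℕ (a mod M) ≈ a
  toℕ-mod a = ≈-trans (≡⇒≈ (toℕ-fromℕ< _)) (%-≈ a)

  toℕ-+ℕ : ∀ (x : Fin M) c → toℕ (x +ℕ c) ≈ toℕ x + c
  toℕ-+ℕ x c = toℕ-mod (toℕ x + c)

  toℕ-⊕ : ∀ (x y : Fin M) → toℕ (x ⊕ y) ≈ toℕ x + toℕ y
  toℕ-⊕ x y = toℕ-+ℕ x (toℕ y)

  toℕ-⊖ : ∀ (y : Fin M) → toℕ (⊖ y) + toℕ y ≈ 0
  toℕ-⊖ y = begin
      toℕ (⊖ y) + toℕ y    ≈⟨ +-congʳ (toℕ y) (toℕ-mod (M ∸ toℕ y)) ⟩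
      (M ∸ toℕ y) + toℕ y  ≡⟨ m∸n+n≡m (<⇒≤ (toℕ<n y)) ⟩
      M                    ≈⟨ M≈0 ⟩
      0                    ∎
    where open ≈-Reasoning

  toℕ-⊝ : ∀ (x y : Fin M) → toℕ (x ⊝ y) + toℕ y ≈ toℕ x
  toℕ-⊝ x y = begin
      toℕ (x ⊝ y) + toℕ y            ≈⟨ +-congʳ (toℕ y) (toℕ-⊕ x (⊖ y)) ⟩
      (toℕ x + toℕ (⊖ y)) + toℕ y    ≡⟨ +-assoc (toℕ x) _ _ ⟩
      toℕ x + (toℕ (⊖ y) + toℕ y)    ≈⟨ +-congˡ (toℕ x) (toℕ-⊖ y) ⟩
      toℕ x + 0                      ≡⟨ +-identityʳ _ ⟩
      toℕ x                          ∎
    where open ≈-Reasoning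

  toℕ-⊝-self : ∀ (x : Fin M) → toℕ (x ⊝ x) ≈ 0
  toℕ-⊝-self x = +-cancelʳ (toℕ x) (toℕ-⊝ x x)

  -- (i + j) - i = j; in D_n and Q_n this is conjugation of a^j by a^i
  ⊕-⊝-cancel : ∀ (i j : Fin M) → (i ⊕ j) ⊝ i ≡ j
  ⊕-⊝-cancel i j = toℕ-injective-≈ (+-cancelʳ (toℕ i) (begin
      toℕ ((i ⊕ j) ⊝ i) + toℕ i  ≈⟨ toℕ-⊝ (i ⊕ j) i ⟩
      toℕ (i ⊕ j)                ≈⟨ toℕ-⊕ i j ⟩
      toℕ i + toℕ j              ≡⟨ +-comm (toℕ i) (toℕ j) ⟩
      toℕ j + toℕ i              ∎))
    where open ≈-Reasoning

-- The reduction ℤ/2n → ℤ/n (n = suc n') and the half-turn k ↦ k + n of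
-- ℤ/2n, whose orbits are exactly the fibres of the reduction.

module Reduction (n' : ℕ) where

  n : ℕ
  n = suc n'

  -- N is 2 * n, written so that it is visibly a successor
  N : ℕ
  N = suc (n' + suc (n' + 0))

  module ℤₙ = Congruence n'
  module ℤ₂ₙ = Congruence (n' + suc (n' + 0))
  open ℤₙ using () renaming (_≈_ to _≈ₙ_)
  open ℤ₂ₙ using () renaming (_≈_ to _≈₂ₙ_)

  ≈₂ₙ⇒≈ₙ : ∀ {a b} → a ≈₂ₙ b → a ≈ₙ b
  ≈₂ₙ⇒≈ₙ {a} {b} ℤ₂ₙ.⟨ q ⟩ = ℤₙ.⟨ begin
      a % n      ≡⟨ m∣n⇒o%n%m≡o%m n N a n∣N ⟨
      a % N % n  ≡⟨ cong (_% n) q ⟩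
      b % N % n  ≡⟨ m∣n⇒o%n%m≡o%m n N b n∣N ⟩
      b % n      ∎ ⟩
    where
    open ≡-Reasoning
    n∣N : n ∣ N
    n∣N = divides 2 refl

  reduce : Fin N → Fin n
  reduce k = toℕ k mod n

  lift : Fin n → Fin N
  lift x = toℕ x mod N

  half : Fin N
  half = n mod N

  n+n≡N : n + n ≡ N
  n+n≡N = cong (n +_) (sym (+-identityʳ n))

  n+n≈0 : ∀ a → (a + n) + n ≈₂ₙ a
  n+n≈0 a = ℤ₂ₙ.≈-trans (ℤ₂ₙ.≡⇒≈ (trans (+-assoc a n n) (cong (a +_) n+n≡N)))
                       (ℤ₂ₙ.≈-trans (ℤ₂ₙ.+-congˡ a ℤ₂ₙ.M≈0) (ℤ₂ₙ.≡⇒≈ (+-identityʳ a)))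

  reduce-⊕ : ∀ i j → reduce (i ⊕ j) ≡ reduce i ⊕ reduce j
  reduce-⊕ i j = ℤₙ.toℕ-injective-≈ (begin
      toℕ (reduce (i ⊕ j))        ≈⟨ ℤₙ.toℕ-mod _ ⟩
      toℕ (i ⊕ j)                 ≈⟨ ≈₂ₙ⇒≈ₙ (ℤ₂ₙ.toℕ-⊕ i j) ⟩
      toℕ i + toℕ j               ≈⟨ ℤₙ.+-cong (ℤₙ.toℕ-mod (toℕ i)) (ℤₙ.toℕ-mod (toℕ j)) ⟨
      toℕ (reduce i) + toℕ (reduce j)  ≈⟨ ℤₙ.toℕ-⊕ (reduce i) (reduce j) ⟨
      toℕ (reduce i ⊕ reduce j)   ∎)
    where open ℤₙ.≈-Reasoning

  reduce-⊝ : ∀ i j → reduce (i ⊝ j) ≡ reduce i ⊝ reduce j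
  reduce-⊝ i j = ℤₙ.toℕ-injective-≈ (ℤₙ.+-cancelʳ (toℕ j) (begin
      toℕ (reduce (i ⊝ j)) + toℕ j         ≈⟨ ℤₙ.+-congʳ (toℕ j) (ℤₙ.toℕ-mod _) ⟩
      toℕ (i ⊝ j) + toℕ j                  ≈⟨ ≈₂ₙ⇒≈ₙ (ℤ₂ₙ.toℕ-⊝ i j) ⟩
      toℕ i                                ≈⟨ ℤₙ.toℕ-mod (toℕ i) ⟨
      toℕ (reduce i)                       ≈⟨ ℤₙ.toℕ-⊝ (reduce i) (reduce j) ⟨
      toℕ (reduce i ⊝ reduce j) + toℕ (reduce j)
                                           ≈⟨ ℤₙ.+-congˡ _ (ℤₙ.toℕ-mod (toℕ j)) ⟩
      toℕ (reduce i ⊝ reduce j) + toℕ j    ∎))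
    where open ℤₙ.≈-Reasoning

  reduce-⊖ : ∀ i → reduce (⊖ i) ≡ ⊖ (reduce i)
  reduce-⊖ i = ℤₙ.toℕ-injective-≈ (ℤₙ.+-cancelʳ (toℕ i) (begin
      toℕ (reduce (⊖ i)) + toℕ i               ≈⟨ ℤₙ.+-congʳ (toℕ i) (ℤₙ.toℕ-mod _) ⟩
      toℕ (⊖ i) + toℕ i                        ≈⟨ ≈₂ₙ⇒≈ₙ (ℤ₂ₙ.toℕ-⊖ i) ⟩
      0                                        ≈⟨ ℤₙ.toℕ-⊖ (reduce i) ⟨
      toℕ (⊖ (reduce i)) + toℕ (reduce i)      ≈⟨ ℤₙ.+-congˡ _ (ℤₙ.toℕ-mod (toℕ i)) ⟩
      toℕ (⊖ (reduce i)) + toℕ i               ∎))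
    where open ℤₙ.≈-Reasoning

  reduce-+n : ∀ k → reduce (k +ℕ n) ≡ reduce k
  reduce-+n k = ℤₙ.toℕ-injective-≈ (begin
      toℕ (reduce (k +ℕ n))  ≈⟨ ℤₙ.toℕ-mod _ ⟩
      toℕ (k +ℕ n)           ≈⟨ ≈₂ₙ⇒≈ₙ (ℤ₂ₙ.toℕ-+ℕ k n) ⟩
      toℕ k + n              ≈⟨ ℤₙ.+-congˡ (toℕ k) ℤₙ.M≈0 ⟩
      toℕ k + 0              ≡⟨ +-identityʳ _ ⟩
      toℕ k                  ≈⟨ ℤₙ.toℕ-mod (toℕ k) ⟨
      toℕ (reduce k)         ∎)
    where open ℤₙ.≈-Reasoning

  reduce∘lift : ∀ x → reduce (lift x) ≡ x
  reduce∘lift x = ℤₙ.toℕ-injective-≈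
    (ℤₙ.≈-trans (ℤₙ.toℕ-mod _) (≈₂ₙ⇒≈ₙ (ℤ₂ₙ.toℕ-mod (toℕ x))))

  ⊕-half : ∀ k → k ⊕ half ≡ k +ℕ n
  ⊕-half k = ℤ₂ₙ.toℕ-injective-≈ (begin
      toℕ (k ⊕ half)      ≈⟨ ℤ₂ₙ.toℕ-⊕ k half ⟩
      toℕ k + toℕ half    ≈⟨ ℤ₂ₙ.+-congˡ (toℕ k) (ℤ₂ₙ.toℕ-mod n) ⟩
      toℕ k + n           ≈⟨ ℤ₂ₙ.toℕ-+ℕ k n ⟨
      toℕ (k +ℕ n)        ∎)
    where open ℤ₂ₙ.≈-Reasoning

  ⊝-half : ∀ k → k ⊝ half ≡ k +ℕ n
  ⊝-half k = ℤ₂ₙ.toℕ-injective-≈ (ℤ₂ₙ.+-cancelʳ (toℕ half) (begin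
      toℕ (k ⊝ half) + toℕ half   ≈⟨ ℤ₂ₙ.toℕ-⊝ k half ⟩
      toℕ k                       ≈⟨ n+n≈0 (toℕ k) ⟨
      (toℕ k + n) + n             ≈⟨ ℤ₂ₙ.+-cong (ℤ₂ₙ.toℕ-+ℕ k n) (ℤ₂ₙ.toℕ-mod n) ⟨
      toℕ (k +ℕ n) + toℕ half     ∎))
    where open ℤ₂ₙ.≈-Reasoning

  +n-involutive : ∀ k → (k +ℕ n) +ℕ n ≡ k
  +n-involutive k = ℤ₂ₙ.toℕ-injective-≈ (begin
      toℕ ((k +ℕ n) +ℕ n)  ≈⟨ ℤ₂ₙ.toℕ-+ℕ (k +ℕ n) n ⟩
      toℕ (k +ℕ n) + n     ≈⟨ ℤ₂ₙ.+-congʳ n (ℤ₂ₙ.toℕ-+ℕ k n) ⟩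
      (toℕ k + n) + n      ≈⟨ n+n≈0 (toℕ k) ⟩
      toℕ k                ∎)
    where open ℤ₂ₙ.≈-Reasoning

  ⊕-+n : ∀ i j → (i ⊕ j) +ℕ n ≡ i ⊕ (j +ℕ n)
  ⊕-+n i j = ℤ₂ₙ.toℕ-injective-≈ (begin
      toℕ ((i ⊕ j) +ℕ n)     ≈⟨ ℤ₂ₙ.toℕ-+ℕ (i ⊕ j) n ⟩
      toℕ (i ⊕ j) + n        ≈⟨ ℤ₂ₙ.+-congʳ n (ℤ₂ₙ.toℕ-⊕ i j) ⟩
      (toℕ i + toℕ j) + n    ≡⟨ +-assoc (toℕ i) (toℕ j) n ⟩
      toℕ i + (toℕ j + n)    ≈⟨ ℤ₂ₙ.+-congˡ (toℕ i) (ℤ₂ₙ.toℕ-+ℕ j n) ⟨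
      toℕ i + toℕ (j +ℕ n)   ≈⟨ ℤ₂ₙ.toℕ-⊕ i (j +ℕ n) ⟨
      toℕ (i ⊕ (j +ℕ n))     ∎)
    where open ℤ₂ₙ.≈-Reasoning

  ⊝-+n : ∀ i j → (i ⊝ j) +ℕ n ≡ i ⊝ (j +ℕ n)
  ⊝-+n i j = ℤ₂ₙ.toℕ-injective-≈ (ℤ₂ₙ.+-cancelʳ (toℕ (j +ℕ n)) (begin
      toℕ ((i ⊝ j) +ℕ n) + toℕ (j +ℕ n)  ≈⟨ ℤ₂ₙ.+-cong (ℤ₂ₙ.toℕ-+ℕ (i ⊝ j) n) (ℤ₂ₙ.toℕ-+ℕ j n) ⟩
      (w + n) + (toℕ j + n)              ≡⟨ rearrange w (toℕ j) ⟩
      ((w + toℕ j) + n) + n              ≈⟨ n+n≈0 (w + toℕ j) ⟩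
      w + toℕ j                          ≈⟨ ℤ₂ₙ.toℕ-⊝ i j ⟩
      toℕ i                              ≈⟨ ℤ₂ₙ.toℕ-⊝ i (j +ℕ n) ⟨
      toℕ (i ⊝ (j +ℕ n)) + toℕ (j +ℕ n)  ∎))
    where
    open ℤ₂ₙ.≈-Reasoning
    open +-*-Solver using (solve; _:+_; _:=_; con)
    w = toℕ (i ⊝ j)
    rearrange : ∀ a b → (a + n) + (b + n) ≡ ((a + b) + n) + n
    rearrange = solve 2 (λ a b → (a :+ con n) :+ (b :+ con n) := ((a :+ b) :+ con n) :+ con n) refl

  ⊝-self-+n : ∀ k → (k ⊝ k) +ℕ n ≡ half
  ⊝-self-+n k = ℤ₂ₙ.toℕ-injective-≈ (begin
      toℕ ((k ⊝ k) +ℕ n)  ≈⟨ ℤ₂ₙ.toℕ-+ℕ (k ⊝ k) n ⟩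
      toℕ (k ⊝ k) + n     ≈⟨ ℤ₂ₙ.+-congʳ n (ℤ₂ₙ.toℕ-⊝-self k) ⟩
      n                   ≈⟨ ℤ₂ₙ.toℕ-mod n ⟨
      toℕ half            ∎)
    where open ℤ₂ₙ.≈-Reasoning

  -- (i - j) - (i + n) + n = -j; in Q_n this is conjugation of a^j by a^i b
  ⊝-conj : ∀ i j → ((i ⊝ j) ⊝ (i +ℕ n)) +ℕ n ≡ ⊖ j
  ⊝-conj i j = begin
      ((i ⊝ j) ⊝ (i +ℕ n)) +ℕ n   ≡⟨ ⊝-+n (i ⊝ j) (i +ℕ n) ⟩
      (i ⊝ j) ⊝ ((i +ℕ n) +ℕ n)   ≡⟨ cong ((i ⊝ j) ⊝_) (+n-involutive i) ⟩
      (i ⊕ (⊖ j)) ⊝ i             ≡⟨ ℤ₂ₙ.⊕-⊝-cancel i (⊖ j) ⟩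
      ⊖ j                         ∎
    where open ≡-Reasoning

  lift∘reduce : ∀ k → lift (reduce k) ≡ k ⊎ lift (reduce k) ≡ k +ℕ n
  lift∘reduce k with toℕ k <? n
  ... | yes k<n = inj₁ (ℤ₂ₙ.toℕ-injective-≈ (begin
        toℕ (lift (reduce k))  ≈⟨ ℤ₂ₙ.toℕ-mod _ ⟩
        toℕ (reduce k)         ≡⟨ toℕ-fromℕ< _ ⟩
        toℕ k % n              ≡⟨ m<n⇒m%n≡m k<n ⟩
        toℕ k                  ∎))
    where open ℤ₂ₙ.≈-Reasoning
  ... | no k≮n = inj₂ (ℤ₂ₙ.toℕ-injective-≈ (begin
        toℕ (lift (reduce k))  ≈⟨ ℤ₂ₙ.toℕ-mod _ ⟩
        toℕ (reduce k)         ≡⟨ toℕ-fromℕ< _ ⟩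
        a % n                  ≡⟨ m≤n⇒[n∸m]%m≡n%m n≤a ⟨
        (a ∸ n) % n            ≡⟨ m<n⇒m%n≡m a∸n<n ⟩
        a ∸ n                  ≈⟨ n+n≈0 (a ∸ n) ⟨
        ((a ∸ n) + n) + n      ≡⟨ cong (_+ n) (m∸n+n≡m n≤a) ⟩
        a + n                  ≈⟨ ℤ₂ₙ.toℕ-+ℕ k n ⟨
        toℕ (k +ℕ n)           ∎))
    where
    open ℤ₂ₙ.≈-Reasoning
    a = toℕ k
    n≤a : n ≤ a
    n≤a = ≮⇒≥ k≮n
    a∸n<n : a ∸ n < n
    a∸n<n = subst (a ∸ n <_) (m+n∸m≡n n n) (∸-monoˡ-< (subst (a <_) (sym n+n≡N) (toℕ<n k)) n≤a)

  reduce-fibre : ∀ k k′ → reduce k ≡ reduce k′ → k ≡ k′ ⊎ k ≡ k′ +ℕ n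
  reduce-fibre k k′ e with lift∘reduce k | lift∘reduce k′
  ... | inj₁ p | inj₁ q = inj₁ (trans (sym p) (trans (cong lift e) q))
  ... | inj₁ p | inj₂ q = inj₂ (trans (sym p) (trans (cong lift e) q))
  ... | inj₂ p | inj₁ q =
    inj₂ (trans (sym (+n-involutive k)) (cong (_+ℕ n) (trans (sym p) (trans (cong lift e) q))))
  ... | inj₂ p | inj₂ q =
    inj₁ (trans (sym (+n-involutive k))
           (trans (cong (_+ℕ n) (trans (sym p) (trans (cong lift e) q))) (+n-involutive k′)))

member : ∀ {m} → Elt m → Sub m → Bool
member (k , false) (R , S) = lookup R k
member (k , true)  (R , S) = lookup S k

∈ₛ⇔member : ∀ {m} (x : Elt m) (H : Sub m) → x ∈ₛ H ⇔ member x H ≡ true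
∈ₛ⇔member (k , false) (R , S) = mk⇔ []=⇒lookup (lookup⇒[]= k R)
∈ₛ⇔member (k , true)  (R , S) = mk⇔ []=⇒lookup (lookup⇒[]= k S)

∈-tabulate : ∀ {m} (g : Fin m → Bool) k → k FS.∈ tabulate g ⇔ g k ≡ true
∈-tabulate g k = mk⇔ (λ k∈ → trans (sym (lookup∘tabulate g k)) ([]=⇒lookup k∈))
                     (λ gk → lookup⇒[]= k _ (trans (lookup∘tabulate g k) gk))

preimage : ∀ {m m′} → (Elt m → Elt m′) → Sub m′ → Sub m
preimage f H = tabulate (λ k → member (f (k , false)) H)
             , tabulate (λ k → member (f (k , true)) H)

∈-preimage : ∀ {m m′} (f : Elt m → Elt m′) H x → x ∈ₛ preimage f H ⇔ f x ∈ₛ H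
∈-preimage f H (k , false) = ⇔-trans (∈-tabulate _ k) (⇔-sym (∈ₛ⇔member (f (k , false)) H))
∈-preimage f H (k , true)  = ⇔-trans (∈-tabulate _ k) (⇔-sym (∈ₛ⇔member (f (k , true)) H))

Sub-ext : ∀ {m} {H K : Sub m} → (∀ x → x ∈ₛ H → x ∈ₛ K) → (∀ x → x ∈ₛ K → x ∈ₛ H) → H ≡ K
Sub-ext H⊆K K⊆H =
  cong₂ _,_ (⊆-antisym (λ {k} → H⊆K (k , false)) (λ {k} → K⊆H (k , false)))
            (⊆-antisym (λ {k} → H⊆K (k , true))  (λ {k} → K⊆H (k , true)))

∈-full : ∀ {m} (x : Elt m) → x ∈ₛ full
∈-full (k , false) = ∈⊤
∈-full (k , true)  = ∈⊤

-- The correspondence theorem for a two-to-one quotient G → G′ whose kernel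
-- {e, z} lies in every vertex of Γ_N(G): then H ↦ π(H) is an isomorphism
-- Γ_N(G) ≅ Γ_N(G′).

module Correspondence {m m′ : ℕ} (G : Grp m) (G′ : Grp m′) where
  open Grp G
  open Grp G′ using () renaming (_·_ to _·′_; e to e′; _⁻¹ to _⁻¹′)

  record DoubleCover : Set where
    field
      π             : Elt m → Elt m′
      σ             : Elt m′ → Elt m
      z             : Elt m
      π-e           : π e ≡ e′
      π-·           : ∀ x y → π (x · y) ≡ (π x ·′ π y)
      π-⁻¹          : ∀ x → π (x ⁻¹) ≡ (π x) ⁻¹′
      π∘σ           : ∀ y → π (σ y) ≡ y
      fibre         : ∀ x y → π x ≡ π y → x ≡ y ⊎ x ≡ (y · z)
      ·z-assoc      : ∀ x y → ((x · y) · z) ≡ (x · (y · z))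
      ·z-involutive : ∀ x → ((x · z) · z) ≡ x

  module _ (cover : DoubleCover)
           (z∈vertex : ∀ H → IsVertex G H → DoubleCover.z cover ∈ₛ H) where
    open DoubleCover cover

    -- π(H) for subgroups H containing z, presented as {y | σ y ∈ H}
    image : Sub m → Sub m′
    image = preimage σ

    σ∘π : ∀ x → σ (π x) ≡ x ⊎ σ (π x) ≡ (x · z)
    σ∘π x = fibre (σ (π x)) x (π∘σ (π x))

    π∘σ-· : ∀ y₁ y₂ → π (σ y₁ · σ y₂) ≡ (y₁ ·′ y₂)
    π∘σ-· y₁ y₂ = trans (π-· (σ y₁) (σ y₂)) (cong₂ _·′_ (π∘σ y₁) (π∘σ y₂))

    π∘σ-⁻¹ : ∀ y → π (σ y ⁻¹) ≡ y ⁻¹′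
    π∘σ-⁻¹ y = trans (π-⁻¹ (σ y)) (cong _⁻¹′ (π∘σ y))

    π-conj : ∀ g h → π ((g · h) · (g ⁻¹)) ≡ ((π g ·′ π h) ·′ (π g ⁻¹′))
    π-conj g h = trans (π-· (g · h) (g ⁻¹)) (cong₂ _·′_ (π-· g h) (π-⁻¹ g))

    preimage-subgroup : ∀ {H′} → IsSubgroup G′ H′ → IsSubgroup G (preimage π H′)
    preimage-subgroup {H′} sg = record
      { has-e   = from (∈-preimage π H′ e) (subst (_∈ₛ H′) (sym π-e) has-e)
      ; closed· = λ x y x∈ y∈ → from (∈-preimage π H′ (x · y)) (subst (_∈ₛ H′) (sym (π-· x y))
                    (closed· (π x) (π y) (to (∈-preimage π H′ x) x∈) (to (∈-preimage π H′ y) y∈)))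
      ; closed⁻ = λ x x∈ → from (∈-preimage π H′ (x ⁻¹)) (subst (_∈ₛ H′) (sym (π-⁻¹ x))
                    (closed⁻ (π x) (to (∈-preimage π H′ x) x∈)))
      }
      where open IsSubgroup sg

    -- membership in a vertex H depends only on the image under π, since z ∈ H
    module Vertex {H : Sub m} (vH : IsVertex G H) where
      open IsSubgroup (proj₁ vH)

      ·z-closed : ∀ x → x ∈ₛ H → (x · z) ∈ₛ H
      ·z-closed x x∈ = closed· x z x∈ (z∈vertex H vH)

      ·z-reflect : ∀ x → (x · z) ∈ₛ H → x ∈ₛ H
      ·z-reflect x xz∈ = subst (_∈ₛ H) (·z-involutive x) (·z-closed (x · z) xz∈)

      π-∈ : ∀ x → x ∈ₛ H → π x ∈ₛ image H
      π-∈ x x∈ with σ∘π x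
      ... | inj₁ p = from (∈-preimage σ H (π x)) (subst (_∈ₛ H) (sym p) x∈)
      ... | inj₂ p = from (∈-preimage σ H (π x)) (subst (_∈ₛ H) (sym p) (·z-closed x x∈))

      π-∈⁻ : ∀ x → π x ∈ₛ image H → x ∈ₛ H
      π-∈⁻ x πx∈ with σ∘π x
      ... | inj₁ p = subst (_∈ₛ H) p (to (∈-preimage σ H (π x)) πx∈)
      ... | inj₂ p = ·z-reflect x (subst (_∈ₛ H) p (to (∈-preimage σ H (π x)) πx∈))

      σ-∈ : ∀ y → y ∈ₛ image H → σ y ∈ₛ H
      σ-∈ y = to (∈-preimage σ H y)

      image-subgroup : IsSubgroup G′ (image H)
      image-subgroup = record
        { has-e   = subst (_∈ₛ image H) π-e (π-∈ e has-e)
        ; closed· = λ y₁ y₂ y₁∈ y₂∈ → subst (_∈ₛ image H) (π∘σ-· y₁ y₂)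
                      (π-∈ _ (closed· (σ y₁) (σ y₂) (σ-∈ y₁ y₁∈) (σ-∈ y₂ y₂∈)))
        ; closed⁻ = λ y y∈ → subst (_∈ₛ image H) (π∘σ-⁻¹ y) (π-∈ _ (closed⁻ (σ y) (σ-∈ y y∈)))
        }

      image-vertex : IsVertex G′ (image H)
      image-vertex = image-subgroup , image-proper , image-non-normal
        where
        image-proper : ¬ image H ≡ full
        image-proper eq = proj₁ (proj₂ vH)
          (Sub-ext (λ x _ → ∈-full x) (λ x _ → π-∈⁻ x (subst (π x ∈ₛ_) (sym eq) (∈-full (π x)))))
        image-non-normal : ¬ IsNormal G′ (image H)
        image-non-normal normal = proj₂ (proj₂ vH) λ g h h∈ →
          π-∈⁻ _ (subst (_∈ₛ image H) (sym (π-conj g h)) (normal (π g) (π h) (π-∈ h h∈)))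

    open Vertex using (π-∈; π-∈⁻; σ-∈; ·z-closed; image-vertex)

    image-injective : ∀ H K → IsVertex G H → IsVertex G K → image H ≡ image K → H ≡ K
    image-injective H K vH vK eq =
      Sub-ext (λ x x∈ → π-∈⁻ vK x (subst (π x ∈ₛ_) eq (π-∈ vH x x∈)))
              (λ x x∈ → π-∈⁻ vH x (subst (π x ∈ₛ_) (sym eq) (π-∈ vK x x∈)))

    image-surjective : ∀ H′ → IsVertex G′ H′ → Σ (Sub m) λ H → IsVertex G H × image H ≡ H′
    image-surjective H′ (sg , proper , non-normal) =
      preimage π H′ , (preimage-subgroup sg , pre-proper , pre-non-normal) , image-pre
      where
      σ-pre : ∀ y → y ∈ₛ H′ → σ y ∈ₛ preimage π H′
      σ-pre y y∈ = from (∈-preimage π H′ (σ y)) (subst (_∈ₛ H′) (sym (π∘σ y)) y∈)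
      pre-σ : ∀ y → σ y ∈ₛ preimage π H′ → y ∈ₛ H′
      pre-σ y σy∈ = subst (_∈ₛ H′) (π∘σ y) (to (∈-preimage π H′ (σ y)) σy∈)
      pre-proper : ¬ preimage π H′ ≡ full
      pre-proper eq = proper
        (Sub-ext (λ y _ → ∈-full y) (λ y _ → pre-σ y (subst (σ y ∈ₛ_) (sym eq) (∈-full (σ y)))))
      pre-non-normal : ¬ IsNormal G (preimage π H′)
      pre-non-normal normal = non-normal λ g h h∈ →
        subst (_∈ₛ H′) (trans (π-· (σ g · σ h) (σ g ⁻¹)) (cong₂ _·′_ (π∘σ-· g h) (π∘σ-⁻¹ g)))
          (to (∈-preimage π H′ _) (normal (σ g) (σ h) (σ-pre h h∈)))
      image-pre : image (preimage π H′) ≡ H′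
      image-pre = Sub-ext (λ y y∈ → pre-σ y (to (∈-preimage σ _ y) y∈))
                          (λ y y∈ → from (∈-preimage σ _ y) (σ-pre y y∈))

    image-⊗ : ∀ H K → IsVertex G H → IsVertex G K
            → (∀ x → _∈_⊗_ G x H K → _∈_⊗_ G x K H)
            → ∀ y → _∈_⊗_ G′ y (image H) (image K) → _∈_⊗_ G′ y (image K) (image H)
    image-⊗ H K vH vK HK⊆KH y (h′ , k′ , h′∈ , k′∈ , y≡)
      with HK⊆KH (σ h′ · σ k′) (σ h′ , σ k′ , σ-∈ vH h′ h′∈ , σ-∈ vK k′ k′∈ , refl)
    ... | (k , h , k∈ , h∈ , eq) =
      π k , π h , π-∈ vK k k∈ , π-∈ vH h h∈ ,
      trans y≡ (trans (sym (π∘σ-· h′ k′)) (trans (cong π eq) (π-· k h)))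

    -- π(H)π(K) ⊆ π(K)π(H) implies HK ⊆ KH: a lift of an element of π(K)π(H)
    -- is correct up to a factor z, which is absorbed into H
    lift-⊗ : ∀ H K → IsVertex G H → IsVertex G K
           → (∀ y → _∈_⊗_ G′ y (image H) (image K) → _∈_⊗_ G′ y (image K) (image H))
           → ∀ x → _∈_⊗_ G x H K → _∈_⊗_ G x K H
    lift-⊗ H K vH vK image⊆ x (h , k , h∈ , k∈ , x≡)
      with image⊆ (π x) (π h , π k , π-∈ vH h h∈ , π-∈ vK k k∈ , trans (cong π x≡) (π-· h k))
    ... | (k′ , h′ , k′∈ , h′∈ , πx≡)
      with fibre x (σ k′ · σ h′) (trans πx≡ (sym (π∘σ-· k′ h′)))
    ... | inj₁ eq = σ k′ , σ h′ , σ-∈ vK k′ k′∈ , σ-∈ vH h′ h′∈ , eq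
    ... | inj₂ eq = σ k′ , (σ h′ · z) , σ-∈ vK k′ k′∈ , ·z-closed vH (σ h′) (σ-∈ vH h′ h′∈) ,
                    trans eq (·z-assoc (σ k′) (σ h′))

    image-adjacent : ∀ H K → IsVertex G H → IsVertex G K → Adj G H K ⇔ Adj G′ (image H) (image K)
    image-adjacent H K vH vK = mk⇔
      (λ (H≢K , perm) → (λ eq → H≢K (image-injective H K vH vK eq)) , λ y → mk⇔
         (image-⊗ H K vH vK (λ x → to (perm x)) y) (image-⊗ K H vK vH (λ x → from (perm x)) y))
      (λ (H≢K , perm) → (λ eq → H≢K (cong image eq)) , λ x → mk⇔
         (lift-⊗ H K vH vK (λ y → to (perm y)) x) (lift-⊗ K H vK vH (λ y → from (perm y)) x))

    ΓN-iso : ΓN-Iso G G′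
    ΓN-iso = image , (λ H vH → image-vertex vH) , image-injective , image-surjective , image-adjacent

module QuaternionOverDihedral (n' : ℕ) where
  open Reduction n'

  open Grp (Dic n) using () renaming (_·_ to _·Q_; _⁻¹ to _⁻¹Q)
  open Grp (Dih n) using () renaming (_·_ to _·D_; _⁻¹ to _⁻¹D)

  π : Elt N → Elt n
  π (k , s) = (reduce k , s)

  σ : Elt n → Elt N
  σ (x , s) = (lift x , s)

  -- z = a^n = b², the central involution of Q_n
  z : Elt N
  z = (half , false)

  shift : Elt N → Elt N
  shift (k , s) = (k +ℕ n , s)

  π-· : ∀ x y → π (x ·Q y) ≡ (π x ·D π y)
  π-· (i , false) (j , t)     = cong (_, t) (reduce-⊕ i j)
  π-· (i , true)  (j , false) = cong (_, true) (reduce-⊝ i j)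
  π-· (i , true)  (j , true)  = cong (_, false) (trans (reduce-+n (i ⊝ j)) (reduce-⊝ i j))

  π-⁻¹ : ∀ x → π (x ⁻¹Q) ≡ (π x) ⁻¹D
  π-⁻¹ (i , false) = cong (_, false) (reduce-⊖ i)
  π-⁻¹ (i , true)  = cong (_, true) (reduce-+n i)

  π∘σ : ∀ y → π (σ y) ≡ y
  π∘σ (x , s) = cong (_, s) (reduce∘lift x)

  ·z≡shift : ∀ x → (x ·Q z) ≡ shift x
  ·z≡shift (k , false) = cong (_, false) (⊕-half k)
  ·z≡shift (k , true)  = cong (_, true) (⊝-half k)

  shift-· : ∀ x y → shift (x ·Q y) ≡ (x ·Q shift y)
  shift-· (i , false) (j , t)     = cong (_, t) (⊕-+n i j)
  shift-· (i , true)  (j , false) = cong (_, true) (⊝-+n i j)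
  shift-· (i , true)  (j , true)  = cong (λ k → (k +ℕ n , false)) (⊝-+n i j)

  shift-involutive : ∀ x → shift (shift x) ≡ x
  shift-involutive (k , s) = cong (_, s) (+n-involutive k)

  fibre : ∀ x y → π x ≡ π y → x ≡ y ⊎ x ≡ (y ·Q z)
  fibre (k , s) (k′ , s′) eq with cong proj₂ eq
  ... | refl with reduce-fibre k k′ (cong proj₁ eq)
  ...   | inj₁ k≡k′   = inj₁ (cong (_, s) k≡k′)
  ...   | inj₂ k≡k′+n = inj₂ (trans (cong (_, s) k≡k′+n) (sym (·z≡shift (k′ , s))))

  cover : Correspondence.DoubleCover (Dic n) (Dih n)
  cover = record
    { π = π ; σ = σ ; z = z ; π-e = refl ; π-· = π-· ; π-⁻¹ = π-⁻¹ ; π∘σ = π∘σ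
    ; fibre = fibre
    ; ·z-assoc = λ x y → begin
        ((x ·Q y) ·Q z)    ≡⟨ ·z≡shift (x ·Q y) ⟩
        shift (x ·Q y)     ≡⟨ shift-· x y ⟩
        (x ·Q shift y)     ≡⟨ cong (x ·Q_) (·z≡shift y) ⟨
        (x ·Q (y ·Q z))    ∎
    ; ·z-involutive = λ x → begin
        ((x ·Q z) ·Q z)    ≡⟨ ·z≡shift (x ·Q z) ⟩
        shift (x ·Q z)     ≡⟨ cong shift (·z≡shift x) ⟩
        shift (shift x)    ≡⟨ shift-involutive x ⟩
        x                  ∎
    }
    where open ≡-Reasoning

  square-of-reflection : ∀ k → ((k , true) ·Q (k , true)) ≡ z
  square-of-reflection k = cong (_, false) (⊝-self-+n k)

  rotation-subgroup-normal : ∀ H → IsSubgroup (Dic n) H → (∀ k → ¬ (k , true) ∈ₛ H)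
                           → IsNormal (Dic n) H
  rotation-subgroup-normal H sg no-reflection = conj-closed
    where
    open IsSubgroup sg
    conj-closed : IsNormal (Dic n) H
    conj-closed g           (j , true)  h∈ = ⊥-elim (no-reflection j h∈)
    conj-closed (i , false) (j , false) h∈ =
      subst (_∈ₛ H) (cong (_, false) (sym (ℤ₂ₙ.⊕-⊝-cancel i j))) h∈
    conj-closed (i , true)  (j , false) h∈ =
      subst (_∈ₛ H) (cong (_, false) (sym (⊝-conj i j))) (closed⁻ (j , false) h∈)

  z∈vertex : ∀ H → IsVertex (Dic n) H → z ∈ₛ H
  z∈vertex H (sg , _ , non-normal) with nonempty? (proj₂ H)
  ... | yes (k , k∈) = subst (_∈ₛ H) (square-of-reflection k) (closed· (k , true) (k , true) k∈ k∈)
    where open IsSubgroup sg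
  ... | no none = ⊥-elim (non-normal (rotation-subgroup-normal H sg (λ k k∈ → none (k , k∈))))

-- The argument works for every n ≥ 1.
theorem5p1 : (n : ℕ) → .{{_ : NonZero n}} → 3 ≤ n →
    ΓN-Iso (Dic n) (Dih n)
theorem5p1 (suc n') _ =
  Correspondence.ΓN-iso (Dic (suc n')) (Dih (suc n')) cover z∈vertex
  where open QuaternionOverDihedral n'
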